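{- Let $n \geq 1$ and let $G$ be the sibling tree $ST_n$. Then the total domination number of $G$ is $$\gamma_t(G) = \begin{cases} \frac{1}{7}(2^{n+2}+3) & \text{if } n\equiv 0 \pmod 3,\\ \frac{1}{7}(2^{n+2}-1)+1 & \text{if } n\equiv 1 \pmod 3,\\ \frac{2}{7}(2^{n+1}-1) & \text{if } n\equiv 2 \pmod 3.\end{cases}$$
   Context: The sibling tree $ST_n$ has vertex set $\{1,2,\dots,2^{n+1}-1\}$; its edges are the edges of the complete binary tree of height $n$ in which vertex $x$ has children $2x$ and $2x+1$ (root $1$ at level $0$; vertex $v$ is at level $i$ iff $2^i\le v\le 2^{i+1}-1$), together with the sibling edges $\{2x,2x+1\}$ for every $x$ with $1\le x\le 2^n-1$. A set $S\subseteq V(G)$ is a total dominating set if every vertex of $V(G)$ is adjacent to some vertex of $S$; $\gamma_t(G)$ is the minimum cardinality of a total dominating set. -}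

module Defs where

open import Data.Nat using (ℕ; suc; _+_; _*_; _∸_; _^_; _≤_)
open import Data.Nat.Properties using ()
open import Data.Product using (_×_; Σ; ∃-syntax)
open import Data.Sum using (_⊎_)
open import Data.List using (List; length)
open import Data.List.Membership.Propositional using (_∈_)
open import Data.List.Relation.Unary.All using (All)
open import Data.List.Relation.Unary.Unique.Propositional using (Unique)
open import Relation.Binary.PropositionalEquality using (_≡_; _≢_)

IsVertex : ℕ → ℕ → Set
IsVertex n v = (1 ≤ v) × (v ≤ 2 ^ (n + 1) ∸ 1)

IsChild : ℕ → ℕ → Set
IsChild u v = (v ≡ 2 * u) ⊎ (v ≡ 2 * u + 1)

IsSiblingEdge : ℕ → ℕ → ℕ → Set
IsSiblingEdge n u v =
  ∃[ x ] ((1 ≤ x) × (x ≤ 2 ^ n ∸ 1) ×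
          (((u ≡ 2 * x) × (v ≡ 2 * x + 1)) ⊎ ((u ≡ 2 * x + 1) × (v ≡ 2 * x))))

Adj : ℕ → ℕ → ℕ → Set
Adj n u v = IsVertex n u × IsVertex n v ×
            (IsChild u v ⊎ IsChild v u ⊎ IsSiblingEdge n u v)

IsTotalDominatingSet : ℕ → List ℕ → Set
IsTotalDominatingSet n S =
  Unique S × All (IsVertex n) S ×
  (∀ v → IsVertex n v → ∃[ u ] ((u ∈ S) × Adj n u v))

TotalDominationNumber : ℕ → ℕ → Set
TotalDominationNumber n k =
  (∃[ S ] (IsTotalDominatingSet n S × length S ≡ k)) ×
  (∀ S → IsTotalDominatingSet n S → k ≤ length S)

module Submission where

-- Both bounds
-- are organised around a single function  bound h s d : for a subtree of height
-- h whose root is in S iff s and is already dominated from outside iff d, it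
-- is a lower bound for the size of S inside the subtree; with h = 3m + r it is
-- base h + excess r s d, where 7·base h + 4·2^r = 2^(h+2).
--
-- Lower bound: bound satisfies the one-level recursion  bound (h+1) s d ≤
-- [s] + bound h a (s ∨ c) + bound h c (s ∨ a)  whenever the root is dominated
-- (a, c: its children are in S) — a finite table, checked by evaluation — so
-- induction over the tree bounds |S| from below by bound n false false for
-- every total dominating set S.
-- Upper bound: S = all vertices on the levels L ≥ 1 with n − L ≡ 1 (mod 3),
-- plus the vertex 2 and, when n ≡ 1, the root.  Each such level dominates
-- itself (sibling edges) and its two neighbouring levels; counting S level by
-- level gives exactly bound n false false.

open import Defs
open import Data.Bool using (Bool; true; false; _∨_; _∧_; not; T)
open import Data.Bool.Properties using (∨-zeroʳ; ∨-identityʳ; T-∧)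
open import Data.Empty using (⊥-elim)
open import Data.List using (List; []; _∷_; length)
open import Data.List.Membership.Propositional using (_∈_)
open import Data.List.Relation.Unary.All as All using (All)
open import Data.List.Relation.Unary.Any using (here; there)
open import Data.List.Relation.Unary.AllPairs using ([]; _∷_)
open import Data.List.Relation.Unary.Unique.Propositional using (Unique)
open import Data.Nat
open import Data.Nat.Properties
open import Data.List.Membership.DecPropositional _≟_ using (_∈?_)
open import Data.Nat.DivMod using ([m+n]%n≡m%n)
open import Data.Nat.Tactic.RingSolver using (solve-∀)
open import Data.Product using (_×_; _,_; proj₁; proj₂; ∃-syntax)
open import Data.Sum using (_⊎_; inj₁; inj₂)
open import Data.Unit using (tt)
open import Function using (_∘_)
open import Function.Bundles using (Equivalence)
open import Relation.Nullary using (¬_; yes; no)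
open import Relation.Nullary.Decidable using (isYes)
open import Relation.Binary.PropositionalEquality

rangeSum : (ℕ → ℕ) → ℕ → ℕ → ℕ
rangeSum f a zero    = 0
rangeSum f a (suc k) = f a + rangeSum f (suc a) k

treeSum : (ℕ → ℕ) → ℕ → ℕ → ℕ
treeSum f v zero    = f v
treeSum f v (suc h) = f v + (treeSum f (2 * v) h + treeSum f (2 * v + 1) h)

rangeSum-split : ∀ f a k l → rangeSum f a (k + l) ≡ rangeSum f a k + rangeSum f (a + k) l
rangeSum-split f a zero    l = cong (λ z → rangeSum f z l) (sym (+-identityʳ a))
rangeSum-split f a (suc k) l rewrite rangeSum-split f (suc a) k l | +-suc a k =
  sym (+-assoc (f a) (rangeSum f (suc a) k) (rangeSum f (suc (a + k)) l))

rangeSum-+ : ∀ f g a k → rangeSum (λ w → f w + g w) a k ≡ rangeSum f a k + rangeSum g a k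
rangeSum-+ f g a zero    = refl
rangeSum-+ f g a (suc k) rewrite rangeSum-+ f g (suc a) k =
  interchange (f a) (g a) (rangeSum f (suc a) k) (rangeSum g (suc a) k)
  where
  interchange : ∀ x y z t → x + y + (z + t) ≡ x + z + (y + t)
  interchange = solve-∀

rangeSum-pairs : ∀ g a k →
  rangeSum (λ w → g (2 * w) + g (2 * w + 1)) a k ≡ rangeSum g (2 * a) (2 * k)
rangeSum-pairs g a zero    = refl
rangeSum-pairs g a (suc k) = sym (begin
  rangeSum g (2 * a) (2 * suc k)
    ≡⟨ cong (rangeSum g (2 * a)) (*-suc 2 k) ⟩
  g (2 * a) + (g (suc (2 * a)) + rangeSum g (suc (suc (2 * a))) (2 * k))
    ≡⟨ cong₂ (λ x y → g (2 * a) + (g x + rangeSum g y (2 * k)))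
             (+-comm 1 (2 * a)) (sym (*-suc 2 a)) ⟩
  g (2 * a) + (g (2 * a + 1) + rangeSum g (2 * suc a) (2 * k))
    ≡⟨ sym (+-assoc (g (2 * a)) _ _) ⟩
  g (2 * a) + g (2 * a + 1) + rangeSum g (2 * suc a) (2 * k)
    ≡⟨ cong (g (2 * a) + g (2 * a + 1) +_) (sym (rangeSum-pairs g (suc a) k)) ⟩
  rangeSum (λ w → g (2 * w) + g (2 * w + 1)) a (suc k) ∎)
  where open ≡-Reasoning

treeSum-tiling : ∀ f h a →
  rangeSum f 0 a + rangeSum (λ v → treeSum f v h) a a ≡ rangeSum f 0 (a * 2 ^ suc h)
treeSum-tiling f zero a =
  trans (sym (rangeSum-split f 0 a a)) (cong (rangeSum f 0) (double a))
  where
  double : ∀ a → a + a ≡ a * (2 * 1)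
  double = solve-∀
treeSum-tiling f (suc h) a = begin
  rangeSum f 0 a + rangeSum (λ v → treeSum f v (suc h)) a a
    ≡⟨ cong (rangeSum f 0 a +_) (rangeSum-+ f _ a a) ⟩
  rangeSum f 0 a + (rangeSum f a a + rangeSum (λ v → treeSum f (2 * v) h + treeSum f (2 * v + 1) h) a a)
    ≡⟨ cong (λ z → rangeSum f 0 a + (rangeSum f a a + z)) (rangeSum-pairs (λ v → treeSum f v h) a a) ⟩
  rangeSum f 0 a + (rangeSum f a a + rangeSum (λ v → treeSum f v h) (2 * a) (2 * a))
    ≡⟨ sym (+-assoc (rangeSum f 0 a) _ _) ⟩
  rangeSum f 0 a + rangeSum f a a + rangeSum (λ v → treeSum f v h) (2 * a) (2 * a)
    ≡⟨ cong (_+ rangeSum (λ v → treeSum f v h) (2 * a) (2 * a))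
            (trans (sym (rangeSum-split f 0 a a)) (cong (rangeSum f 0) (double a))) ⟩
  rangeSum f 0 (2 * a) + rangeSum (λ v → treeSum f v h) (2 * a) (2 * a)
    ≡⟨ treeSum-tiling f h (2 * a) ⟩
  rangeSum f 0 (2 * a * 2 ^ suc h)
    ≡⟨ cong (rangeSum f 0) (shift a (2 ^ suc h)) ⟩
  rangeSum f 0 (a * 2 ^ suc (suc h)) ∎
  where
  open ≡-Reasoning
  double : ∀ a → a + a ≡ 2 * a
  double = solve-∀
  shift : ∀ a p → 2 * a * p ≡ a * (2 * p)
  shift = solve-∀

-- The whole tree of height h rooted at 1, plus the unused index 0, is [0, 2^(h+1)).
treeSum-root : ∀ f h → f 0 + treeSum f 1 h ≡ rangeSum f 0 (2 ^ suc h)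
treeSum-root f h = begin
  f 0 + treeSum f 1 h
    ≡⟨ sym (cong₂ _+_ (+-identityʳ (f 0)) (+-identityʳ (treeSum f 1 h))) ⟩
  rangeSum f 0 1 + rangeSum (λ v → treeSum f v h) 1 1
    ≡⟨ treeSum-tiling f h 1 ⟩
  rangeSum f 0 (1 * 2 ^ suc h)
    ≡⟨ cong (rangeSum f 0) (*-identityˡ (2 ^ suc h)) ⟩
  rangeSum f 0 (2 ^ suc h) ∎
  where open ≡-Reasoning

rangeSum-mono : ∀ f g a k → (∀ w → f w ≤ g w) → rangeSum f a k ≤ rangeSum g a k
rangeSum-mono f g a zero    f≤g = z≤n
rangeSum-mono f g a (suc k) f≤g = +-mono-≤ (f≤g a) (rangeSum-mono f g (suc a) k f≤g)

indicator : Bool → ℕ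
indicator true  = 1
indicator false = 0

member : List ℕ → ℕ → Bool
member S w = isYes (w ∈? S)

member-true : ∀ {S w} → w ∈ S → member S w ≡ true
member-true {S} {w} w∈S with w ∈? S
... | yes _   = refl
... | no w∉S = ⊥-elim (w∉S w∈S)

member-sound : ∀ {S w} → member S w ≡ true → w ∈ S
member-sound {S} {w} eq with w ∈? S
... | yes w∈S = w∈S

point : ℕ → ℕ → ℕ
point x w = indicator (isYes (w ≟ x))

rangeSum-point-past : ∀ x a k → x < a → rangeSum (point x) a k ≡ 0
rangeSum-point-past x a zero    x<a = refl
rangeSum-point-past x a (suc k) x<a with a ≟ x
... | yes refl = ⊥-elim (<-irrefl refl x<a)
... | no _     = rangeSum-point-past x (suc a) k (m<n⇒m<1+n x<a)

rangeSum-point≤1 : ∀ x a k → rangeSum (point x) a k ≤ 1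
rangeSum-point≤1 x a zero = z≤n
rangeSum-point≤1 x a (suc k) with a ≟ x
... | yes refl = ≤-reflexive (cong suc (rangeSum-point-past x (suc a) k ≤-refl))
... | no _     = rangeSum-point≤1 x (suc a) k

member-∷ : ∀ x S w → indicator (member (x ∷ S) w) ≤ point x w + indicator (member S w)
member-∷ x S w with w ∈? (x ∷ S)
... | no _ = z≤n
... | yes (here refl) with w ≟ w
...   | yes _  = s≤s z≤n
...   | no w≢w = ⊥-elim (w≢w refl)
member-∷ x S w | yes (there w∈S) rewrite member-true {S} {w} w∈S = m≤n+m 1 (point x w)

-- A list has at least as many entries as it has members in any range (no
-- uniqueness is needed for this direction).
count-members≤length : ∀ S a k → rangeSum (indicator ∘ member S) a k ≤ length S
count-members≤length []      a k = ≤-reflexive (rangeSum-nothing a k)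
  where
  rangeSum-nothing : ∀ a k → rangeSum (indicator ∘ member []) a k ≡ 0
  rangeSum-nothing a zero    = refl
  rangeSum-nothing a (suc k) = rangeSum-nothing (suc a) k
count-members≤length (x ∷ S) a k = begin
  rangeSum (indicator ∘ member (x ∷ S)) a k
    ≤⟨ rangeSum-mono _ _ a k (member-∷ x S) ⟩
  rangeSum (λ w → point x w + indicator (member S w)) a k
    ≡⟨ rangeSum-+ (point x) (indicator ∘ member S) a k ⟩
  rangeSum (point x) a k + rangeSum (indicator ∘ member S) a k
    ≤⟨ +-mono-≤ (rangeSum-point≤1 x a k) (count-members≤length S a k) ⟩
  suc (length S) ∎
  where open ≤-Reasoning

select : (ℕ → Bool) → ℕ → ℕ → List ℕ
select b a zero    = []
select b a (suc k) with b a
... | true  = a ∷ select b (suc a) k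
... | false = select b (suc a) k

select-length : ∀ b a k → length (select b a k) ≡ rangeSum (indicator ∘ b) a k
select-length b a zero = refl
select-length b a (suc k) with b a
... | true  = cong suc (select-length b (suc a) k)
... | false = select-length b (suc a) k

∈-select⁻ : ∀ b a k {w} → w ∈ select b a k → (a ≤ w) × (w < a + k) × (b w ≡ true)
∈-select⁻ b a (suc k) {w} w∈ with b a in ba
∈-select⁻ b a (suc k) (here refl) | true = ≤-refl , m<m+n a z<s , ba
∈-select⁻ b a (suc k) (there w∈) | true with ∈-select⁻ b (suc a) k w∈
... | a<w , w<a+k , bw = <⇒≤ a<w , ≤-trans w<a+k (≤-reflexive (sym (+-suc a k))) , bw
∈-select⁻ b a (suc k) w∈ | false with ∈-select⁻ b (suc a) k w∈
... | a<w , w<a+k , bw = <⇒≤ a<w , ≤-trans w<a+k (≤-reflexive (sym (+-suc a k))) , bw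

∈-select⁺ : ∀ b a k {w} → a ≤ w → w < a + k → b w ≡ true → w ∈ select b a k
∈-select⁺ b a zero    a≤w w<a+k bw = ⊥-elim (<⇒≱ w<a+k (≤-trans (≤-reflexive (+-identityʳ a)) a≤w))
∈-select⁺ b a (suc k) {w} a≤w w<a+k bw with a ≟ w | b a in ba
... | yes refl | true  = here refl
... | yes refl | false = ⊥-elim (false≢true (trans (sym ba) bw))
  where
  false≢true : false ≢ true
  false≢true ()
... | no a≢w   | true  =
  there (∈-select⁺ b (suc a) k (≤∧≢⇒< a≤w a≢w) (subst (w <_) (+-suc a k) w<a+k) bw)
... | no a≢w   | false =
  ∈-select⁺ b (suc a) k (≤∧≢⇒< a≤w a≢w) (subst (w <_) (+-suc a k) w<a+k) bw

-- The selection is increasing, hence duplicate free.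
select-unique : ∀ b a k → Unique (select b a k)
select-unique b a zero = []
select-unique b a (suc k) with b a
... | true  = All.tabulate (λ w∈ a≡w → <-irrefl a≡w (proj₁ (∈-select⁻ b (suc a) k w∈)))
              ∷ select-unique b (suc a) k
... | false = select-unique b (suc a) k

2v+1+1≡2[v+1] : ∀ v → suc (2 * v + 1) ≡ 2 * suc v
2v+1+1≡2[v+1] = solve-∀

even≢odd′ : ∀ a c → 2 * a ≢ 2 * c + 1
even≢odd′ a c eq = even≢odd a c (trans eq (+-comm (2 * c) 1))

parent-unique : ∀ {u v w} → IsChild u w → IsChild v w → u ≡ v
parent-unique {u} {v} (inj₁ w≡2u)   (inj₁ w≡2v)   = *-cancelˡ-≡ u v 2 (trans (sym w≡2u) w≡2v)
parent-unique {u} {v} (inj₁ w≡2u)   (inj₂ w≡2v+1) = ⊥-elim (even≢odd′ u v (trans (sym w≡2u) w≡2v+1))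
parent-unique {u} {v} (inj₂ w≡2u+1) (inj₁ w≡2v)   = ⊥-elim (even≢odd′ v u (trans (sym w≡2v) w≡2u+1))
parent-unique {u} {v} (inj₂ w≡2u+1) (inj₂ w≡2v+1) =
  *-cancelˡ-≡ u v 2 (+-cancelʳ-≡ 1 (2 * u) (2 * v) (trans (sym w≡2u+1) w≡2v+1))

root-orphan : ∀ {x} → 1 ≤ x → ¬ IsChild x 1
root-orphan {x} 1≤x (inj₁ 1≡2x)   = even≢odd x 0 (sym 1≡2x)
root-orphan {x} 1≤x (inj₂ 1≡2x+1) = <⇒≢ 1≤x (sym x≡0)
  where
  x≡0 : x ≡ 0
  x≡0 = *-cancelˡ-≡ x 0 2 (sym (+-cancelʳ-≡ 1 0 (2 * x) 1≡2x+1))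

child-≥2 : ∀ {v w} → 1 ≤ v → IsChild v w → 2 ≤ w
child-≥2     1≤v (inj₁ refl) = *-monoʳ-≤ 2 1≤v
child-≥2 {v} 1≤v (inj₂ refl) = ≤-trans (*-monoʳ-≤ 2 1≤v) (m≤m+n (2 * v) 1)

child< : ∀ {v w M} → IsChild v w → v < M → w < 2 * M
child< {v} {w} c v<M =
  ≤-trans (s≤s (child≤ c)) (≤-trans (≤-reflexive (2v+1+1≡2[v+1] v)) (*-monoʳ-≤ 2 v<M))
  where
  child≤ : IsChild v w → w ≤ 2 * v + 1
  child≤ (inj₁ refl) = m≤m+n (2 * v) 1
  child≤ (inj₂ refl) = ≤-refl

parent< : ∀ {v w M} → IsChild v w → w < 2 * M → v < M
parent< {v} {w} {M} c w<2M with v <? M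
... | yes v<M = v<M
... | no  v≮M = ⊥-elim (<⇒≱ w<2M (≤-trans (*-monoʳ-≤ 2 (≮⇒≥ v≮M)) (child≥ c)))
  where
  child≥ : IsChild v w → 2 * v ≤ w
  child≥ (inj₁ refl) = ≤-refl
  child≥ (inj₂ refl) = m≤m+n (2 * v) 1

Siblings : ℕ → ℕ → ℕ → Set
Siblings x u w = ((u ≡ 2 * x) × (w ≡ 2 * x + 1)) ⊎ ((u ≡ 2 * x + 1) × (w ≡ 2 * x))

siblings-child : ∀ {x u w} → Siblings x u w → IsChild x w
siblings-child (inj₁ (_ , w≡2x+1)) = inj₂ w≡2x+1
siblings-child (inj₂ (_ , w≡2x))   = inj₁ w≡2x

siblings-sym : ∀ {x u w} → Siblings x u w → Siblings x w u
siblings-sym (inj₁ (u≡ , w≡)) = inj₂ (w≡ , u≡)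
siblings-sym (inj₂ (u≡ , w≡)) = inj₁ (w≡ , u≡)

sibling-unique : ∀ {x y u u′ w} → Siblings x u w → Siblings y u′ w → u ≡ u′
sibling-unique {x} {y} {w = w} s s′ = other s s′
  where
  x≡y : x ≡ y
  x≡y = parent-unique {x} {y} {w} (siblings-child {x} s) (siblings-child {y} s′)
  other : ∀ {u u′ w} → Siblings x u w → Siblings y u′ w → u ≡ u′
  other (inj₁ (u≡ , _)) (inj₁ (u′≡ , _)) = trans u≡ (trans (cong (2 *_) x≡y) (sym u′≡))
  other (inj₂ (u≡ , _)) (inj₂ (u′≡ , _)) = trans u≡ (trans (cong (λ z → 2 * z + 1) x≡y) (sym u′≡))
  other (inj₁ (_ , w≡)) (inj₂ (_ , w≡′)) = ⊥-elim (even≢odd′ y x (trans (sym w≡′) w≡))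
  other (inj₂ (_ , w≡)) (inj₁ (_ , w≡′)) = ⊥-elim (even≢odd′ x y (trans (sym w≡) w≡′))

halve : ∀ w → ∃[ v ] IsChild v w
halve zero = 0 , inj₁ refl
halve (suc w) with halve w
... | v , inj₁ w≡2v   = v , inj₂ (trans (cong suc w≡2v) (+-comm 1 (2 * v)))
... | v , inj₂ w≡2v+1 = suc v , inj₁ (trans (cong suc w≡2v+1) (2v+1+1≡2[v+1] v))

parent-exists : ∀ w → 2 ≤ w → ∃[ v ] ∃[ w′ ] ((1 ≤ v) × Siblings v w′ w)
parent-exists w 2≤w with halve w
... | zero  , c = ⊥-elim (<⇒≱ (child< {0} {w} {1} c (s≤s z≤n)) 2≤w)
... | suc v , inj₁ w≡2v   = suc v , 2 * suc v + 1 , s≤s z≤n , inj₂ (refl , w≡2v)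
... | suc v , inj₂ w≡2v+1 = suc v , 2 * suc v , s≤s z≤n , inj₁ (refl , w≡2v+1)

m<M⇒m≤M∸1 : ∀ {m} M → m < M → m ≤ M ∸ 1
m<M⇒m≤M∸1 (suc M) (s≤s m≤M) = m≤M

m≤M∸1⇒m<M : ∀ {m} M → 0 < M → m ≤ M ∸ 1 → m < M
m≤M∸1⇒m<M (suc M) _ m≤M = s≤s m≤M

vertex⁻ : ∀ {n w} → IsVertex n w → w < 2 ^ suc n
vertex⁻ {n} {w} (_ , w≤) =
  subst (λ e → w < 2 ^ e) (+-comm n 1) (m≤M∸1⇒m<M (2 ^ (n + 1)) (m^n>0 2 (n + 1)) w≤)

vertex⁺ : ∀ {n w} → 1 ≤ w → w < 2 ^ suc n → IsVertex n w
vertex⁺ {n} {w} 1≤w w< = 1≤w , m<M⇒m≤M∸1 (2 ^ (n + 1)) (subst (λ e → w < 2 ^ e) (+-comm 1 n) w<)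

Level : ℕ → ℕ → Set
Level w L = (2 ^ L ≤ w) × (w < 2 ^ suc L)

level-≤ : ∀ {w L L′} → Level w L → Level w L′ → L ≤ L′
level-≤ {w} {L} {L′} (2^L≤w , _) (_ , w<2^L′+1) with L ≤? L′
... | yes L≤L′ = L≤L′
... | no  L≰L′ = ⊥-elim (<⇒≱ w<2^L′+1 (≤-trans (^-monoʳ-≤ 2 (≰⇒> L≰L′)) 2^L≤w))

level-unique : ∀ {w L L′} → Level w L → Level w L′ → L ≡ L′
level-unique l l′ = ≤-antisym (level-≤ l l′) (level-≤ l′ l)

levelBelow : ℕ → ℕ → ℕ
levelBelow zero    w = 0
levelBelow (suc k) w with 2 ^ k ≤? w
... | yes _ = k
... | no  _ = levelBelow k w

levelBelow-spec : ∀ k w → 1 ≤ w → w < 2 ^ k → Level w (levelBelow k w)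
levelBelow-spec zero    w 1≤w w<1 = ⊥-elim (<⇒≱ w<1 1≤w)
levelBelow-spec (suc k) w 1≤w w<2^k+1 with 2 ^ k ≤? w
... | yes 2^k≤w = 2^k≤w , w<2^k+1
... | no  2^k≰w = levelBelow-spec k w 1≤w (≰⇒> 2^k≰w)

n<2^n : ∀ n → n < 2 ^ n
n<2^n zero    = s≤s z≤n
n<2^n (suc n) = ≤-trans (s≤s (n<2^n n))
  (≤-trans (≤-reflexive (+-comm 1 (2 ^ n))) (+-monoʳ-≤ (2 ^ n) (≤-trans (m^n>0 2 n) (m≤m+n (2 ^ n) 0))))

-- The level of a number w ≥ 1 (computable, so that small cases evaluate).
level : ℕ → ℕ
level w = levelBelow w w

level-spec : ∀ {w} → 1 ≤ w → Level w (level w)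
level-spec {w} 1≤w = levelBelow-spec w w 1≤w (n<2^n w)

level-correct : ∀ {w L} → Level w L → level w ≡ L
level-correct {w} {L} l = level-unique {w} (level-spec {w} (≤-trans (m^n>0 2 L) (proj₁ l))) l

child-level : ∀ {v w L} → IsChild v w → Level v L → Level w (suc L)
child-level {v} (inj₁ refl) (lo , hi) =
  *-monoʳ-≤ 2 lo , ≤-trans (≤-trans (n≤1+n _) (≤-reflexive (sym (*-suc 2 v)))) (*-monoʳ-≤ 2 hi)
child-level {v} (inj₂ refl) (lo , hi) =
  ≤-trans (*-monoʳ-≤ 2 lo) (m≤m+n (2 * v) 1) , ≤-trans (≤-reflexive (2v+1+1≡2[v+1] v)) (*-monoʳ-≤ 2 hi)

level-child : ∀ {v w} → 1 ≤ v → IsChild v w → level w ≡ suc (level v)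
level-child {v} 1≤v c = level-correct (child-level {v} {L = level v} c (level-spec {v} 1≤v))

level-vertex : ∀ {n w L} → Level w L → L ≤ n → IsVertex n w
level-vertex {n} {L = L} (lo , hi) L≤n =
  vertex⁺ {n} (≤-trans (m^n>0 2 L) lo) (≤-trans hi (^-monoʳ-≤ 2 {suc L} {suc n} (s≤s L≤n)))

vertex-level : ∀ {n w} → IsVertex n w → level w ≤ n
vertex-level {n} {w} vw with level-spec {w} (proj₁ vw)
... | lo , _ with level w ≤? n
...   | yes ≤n = ≤n
...   | no  ≰n = ⊥-elim (<⇒≱ (vertex⁻ {n} vw) (≤-trans (^-monoʳ-≤ 2 (≰⇒> ≰n)) lo))

child-height : ∀ {n v w h} → 1 ≤ v → IsChild v w → level v + suc h ≡ n → level w + h ≡ n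
child-height {v = v} {h = h} 1≤v c height =
  trans (cong (_+ h) (level-child {v} 1≤v c)) (trans (sym (+-suc (level v) h)) height)

data Phase : Set where
  p0 p1 p2 : Phase

next : Phase → Phase
next p0 = p1
next p1 = p2
next p2 = p0

residue : Phase → ℕ
residue p0 = 0
residue p1 = 1
residue p2 = 2

isP1 : Phase → Bool
isP1 p1 = true
isP1 _  = false

phase : ℕ → Phase
phase zero    = p0
phase (suc h) = next (phase h)

phase-mod3 : ∀ n → n % 3 ≡ residue (phase n)
phase-mod3 0 = refl
phase-mod3 1 = refl
phase-mod3 2 = refl
phase-mod3 (suc (suc (suc n))) = begin
  (3 + n) % 3                            ≡⟨ cong (_% 3) (+-comm 3 n) ⟩
  (n + 3) % 3                            ≡⟨ [m+n]%n≡m%n n 3 ⟩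
  n % 3                                  ≡⟨ phase-mod3 n ⟩
  residue (phase n)                      ≡⟨ cong residue (sym (next³ (phase n))) ⟩
  residue (next (next (next (phase n)))) ∎
  where
  open ≡-Reasoning
  next³ : ∀ r → next (next (next r)) ≡ r
  next³ p0 = refl
  next³ p1 = refl
  next³ p2 = refl

phase-cases : ∀ j →
  (phase j ≡ p1) ⊎ (phase (suc j) ≡ p1) ⊎ ∃[ j′ ] ((j ≡ suc j′) × (phase j′ ≡ p1))
phase-cases zero = inj₂ (inj₁ refl)
phase-cases (suc j) with phase j in phase-j
... | p0 = inj₁ refl
... | p1 = inj₂ (inj₂ (j , refl , phase-j))
... | p2 = inj₂ (inj₁ refl)

-- The lower-bound function.  bound h s d is a lower bound for the number of
-- vertices of S in a subtree of height h whose root is in S iff s and is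
-- dominated from outside the subtree (by its parent or sibling) if d, when
-- all other vertices of the subtree are dominated.
offset : Phase → ℕ
offset p0 = 0
offset p1 = 0
offset p2 = 4

base : ℕ → ℕ
base zero    = 0
base (suc h) = offset (phase h) + 2 * base h

excess : Phase → Bool → Bool → ℕ
excess p0 false false = 1
excess p0 false true  = 0
excess p0 true  false = 2
excess p0 true  true  = 1
excess p1 false false = 2
excess p1 false true  = 2
excess p1 true  false = 2
excess p1 true  true  = 1
excess p2 false false = 2
excess p2 false true  = 2
excess p2 true  false = 3
excess p2 true  true  = 3

bound : ℕ → Bool → Bool → ℕ
bound h s d = base h + excess (phase h) s d

allBool : (Bool → Bool) → Bool
allBool p = p false ∧ p true

allPhase : (Phase → Bool) → Bool
allPhase p = p p0 ∧ (p p1 ∧ p p2)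

allBool-sound : ∀ p → T (allBool p) → ∀ x → T (p x)
allBool-sound p t false = proj₁ (Equivalence.to (T-∧ {p false} {p true}) t)
allBool-sound p t true  = proj₂ (Equivalence.to (T-∧ {p false} {p true}) t)

allPhase-sound : ∀ p → T (allPhase p) → ∀ r → T (p r)
allPhase-sound p t r with Equivalence.to (T-∧ {p p0} {p p1 ∧ p p2}) t
... | t₀ , t₁₂ with Equivalence.to (T-∧ {p p1} {p p2}) t₁₂ | r
...   | _  , _  | p0 = t₀
...   | t₁ , _  | p1 = t₁
...   | _  , t₂ | p2 = t₂

-- The corrections on the two sides of the recursion of bound, for a root in
-- S iff s, dominated from outside iff d, with children in S iff a and c.
rootCost : Phase → Bool → Bool → ℕ
rootCost r s d = offset r + excess (next r) s d

childrenCost : Phase → Bool → Bool → Bool → ℕ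
childrenCost r s a c = indicator s + (excess r a (s ∨ c) + excess r c (s ∨ a))

excess-step-holds : Phase → Bool → Bool → Bool → Bool → Bool
excess-step-holds r s d a c = not (d ∨ (a ∨ c)) ∨ (rootCost r s d ≤ᵇ childrenCost r s a c)

excess-table : ∀ r s d a c → T (excess-step-holds r s d a c)
excess-table r s d a c =
  allBool-sound (excess-step-holds r s d a) (allBool-sound (P₄ r s d) (allBool-sound (P₃ r s)
    (allBool-sound (P₂ r) (allPhase-sound P₁ tt r) s) d) a) c
  where
  P₄ : Phase → Bool → Bool → Bool → Bool
  P₄ r s d a = allBool (excess-step-holds r s d a)
  P₃ : Phase → Bool → Bool → Bool
  P₃ r s d = allBool (P₄ r s d)
  P₂ : Phase → Bool → Bool
  P₂ r s = allBool (P₃ r s)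
  P₁ : Phase → Bool
  P₁ r = allBool (P₂ r)

excess-step : ∀ r s d a c → d ∨ (a ∨ c) ≡ true → rootCost r s d ≤ childrenCost r s a c
excess-step r s d a c dominated =
  ≤ᵇ⇒≤ _ _ (subst (λ x → T (not x ∨ (rootCost r s d ≤ᵇ childrenCost r s a c))) dominated
                  (excess-table r s d a c))

-- The recursion of the lower bound: a dominated root's subtree of height h+1
-- consists of the root and the subtrees of its two children, each child being
-- dominated from outside by the root (if in S) or by its sibling.
bound-step : ∀ h s d a c → d ∨ (a ∨ c) ≡ true →
  bound (suc h) s d ≤ indicator s + (bound h a (s ∨ c) + bound h c (s ∨ a))
bound-step h s d a c dominated = begin
  offset r + 2 * B + excess (next r) s d   ≡⟨ regroup (offset r) B (excess (next r) s d) ⟩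
  2 * B + rootCost r s d                   ≤⟨ +-monoʳ-≤ (2 * B) (excess-step r s d a c dominated) ⟩
  2 * B + (indicator s + (x + y))          ≡⟨ distribute B (indicator s) x y ⟩
  indicator s + (B + x + (B + y))          ∎
  where
  open ≤-Reasoning
  r = phase h
  B = base h
  x = excess r a (s ∨ c)
  y = excess r c (s ∨ a)
  regroup : ∀ o B e → o + 2 * B + e ≡ 2 * B + (o + e)
  regroup = solve-∀
  distribute : ∀ B t x y → 2 * B + (t + (x + y)) ≡ t + (B + x + (B + y))
  distribute = solve-∀

-- A leaf has no children, so it must be dominated from outside.
bound-leaf : ∀ s d → d ∨ (false ∨ false) ≡ true → bound 0 s d ≤ indicator s
bound-leaf false true _ = z≤n
bound-leaf true  true _ = s≤s z≤n

bound-mono : ∀ h s → bound h false false ≤ bound h s false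
bound-mono h false = ≤-refl
bound-mono h true  = +-monoʳ-≤ (base h) (excess-mono (phase h))
  where
  excess-mono : ∀ r → excess r false false ≤ excess r true false
  excess-mono p0 = s≤s z≤n
  excess-mono p1 = ≤-refl
  excess-mono p2 = s≤s (s≤s z≤n)

weight : Phase → ℕ
weight p0 = 4
weight p1 = 8
weight p2 = 16

-- Closed form: 7·base h = 2^(h+2) − 4·2^(h mod 3).
base-closed : ∀ h → 7 * base h + weight (phase h) ≡ 2 ^ (h + 2)
base-closed zero    = refl
base-closed (suc h) = begin
  7 * (offset r + 2 * B) + weight (next r)  ≡⟨ regroup (offset r) B (weight (next r)) ⟩
  (7 * offset r + weight (next r)) + 14 * B ≡⟨ cong (_+ 14 * B) (weight-next r) ⟩
  2 * weight r + 14 * B                     ≡⟨ factor (weight r) B ⟩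
  2 * (7 * B + weight r)                    ≡⟨ cong (2 *_) (base-closed h) ⟩
  2 * 2 ^ (h + 2)                           ∎
  where
  open ≡-Reasoning
  r = phase h
  B = base h
  weight-next : ∀ r → 7 * offset r + weight (next r) ≡ 2 * weight r
  weight-next p0 = refl
  weight-next p1 = refl
  weight-next p2 = refl
  regroup : ∀ o B w → 7 * (o + 2 * B) + w ≡ (7 * o + w) + 14 * B
  regroup = solve-∀
  factor : ∀ w B → 2 * w + 14 * B ≡ 2 * (7 * B + w)
  factor = solve-∀

bound-value : ∀ n →
  (n % 3 ≡ 0 → 7 * bound n false false ≡ 2 ^ (n + 2) + 3) ×
  (n % 3 ≡ 1 → 7 * bound n false false ≡ (2 ^ (n + 2) ∸ 1) + 7) ×
  (n % 3 ≡ 2 → 7 * bound n false false ≡ 2 * (2 ^ (n + 1) ∸ 1))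
bound-value n rewrite phase-mod3 n with phase n | base-closed n
... | p0 | closed = (λ _ → trans (case0 (base n)) (cong (_+ 3) closed)) , (λ ()) , (λ ())
  where
  case0 : ∀ B → 7 * (B + 1) ≡ 7 * B + 4 + 3
  case0 = solve-∀
... | p1 | closed = (λ ()) , (λ _ → case1) , (λ ())
  where
  open ≡-Reasoning
  B = base n
  case1 : 7 * (B + 2) ≡ (2 ^ (n + 2) ∸ 1) + 7
  case1 = begin
    7 * (B + 2)           ≡⟨ expand B ⟩
    7 * B + 7 + 7         ≡⟨ cong (λ x → x ∸ 1 + 7) (sym (+-suc (7 * B) 7)) ⟩
    (7 * B + 8 ∸ 1) + 7   ≡⟨ cong (λ x → x ∸ 1 + 7) closed ⟩
    (2 ^ (n + 2) ∸ 1) + 7 ∎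
    where
    expand : ∀ B → 7 * (B + 2) ≡ 7 * B + 7 + 7
    expand = solve-∀
... | p2 | closed = (λ ()) , (λ ()) , (λ _ → case2)
  where
  open ≡-Reasoning
  B = base n
  case2 : 7 * (B + 2) ≡ 2 * (2 ^ (n + 1) ∸ 1)
  case2 = sym (begin
    2 * (2 ^ (n + 1) ∸ 1) ≡⟨ *-distribˡ-∸ 2 (2 ^ (n + 1)) 1 ⟩
    2 ^ suc (n + 1) ∸ 2   ≡⟨ cong (λ e → 2 ^ e ∸ 2) (sym (+-suc n 1)) ⟩
    2 ^ (n + 2) ∸ 2       ≡⟨ cong (_∸ 2) (sym closed) ⟩
    7 * B + 16 ∸ 2        ≡⟨ cong (_∸ 2) (shift B) ⟩
    7 * (B + 2) + 2 ∸ 2   ≡⟨ m+n∸n≡m (7 * (B + 2)) 2 ⟩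
    7 * (B + 2)           ∎)
    where
    shift : ∀ B → 7 * B + 16 ≡ 7 * (B + 2) + 2
    shift = solve-∀

module Subtrees (b : ℕ → Bool) where

  Dominated : Bool → ℕ → Set
  Dominated d w = d ∨ (b (2 * w) ∨ b (2 * w + 1)) ≡ true

  WellDominated : ℕ → ℕ → Set
  WellDominated zero    v = (b (2 * v) ≡ false) × (b (2 * v + 1) ≡ false)
  WellDominated (suc h) v =
    Dominated (b v ∨ b (2 * v + 1)) (2 * v) × Dominated (b v ∨ b (2 * v)) (2 * v + 1) ×
    WellDominated h (2 * v) × WellDominated h (2 * v + 1)

  subtree-lower-bound : ∀ h v d → WellDominated h v → Dominated d v →
    bound h (b v) d ≤ treeSum (indicator ∘ b) v h
  subtree-lower-bound zero v d (b2v≡false , b2v+1≡false) dominated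
    rewrite b2v≡false | b2v+1≡false = bound-leaf (b v) d dominated
  subtree-lower-bound (suc h) v d (dom₀ , dom₁ , wd₀ , wd₁) dominated = begin
    bound (suc h) (b v) d
      ≤⟨ bound-step h (b v) d (b (2 * v)) (b (2 * v + 1)) dominated ⟩
    indicator (b v) + (bound h (b (2 * v)) (b v ∨ b (2 * v + 1)) + bound h (b (2 * v + 1)) (b v ∨ b (2 * v)))
      ≤⟨ +-monoʳ-≤ (indicator (b v)) (+-mono-≤ (subtree-lower-bound h (2 * v) _ wd₀ dom₀)
                                               (subtree-lower-bound h (2 * v + 1) _ wd₁ dom₁)) ⟩
    treeSum (indicator ∘ b) v (suc h) ∎
    where open ≤-Reasoning

∨-introˡ : ∀ {x} y → x ≡ true → x ∨ y ≡ true
∨-introˡ y refl = refl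

∨-introʳ : ∀ x {y} → y ≡ true → x ∨ y ≡ true
∨-introʳ x refl = ∨-zeroʳ x

module TotalDominatingSetBound (n : ℕ) (S : List ℕ) (tds : IsTotalDominatingSet n S) where

  b : ℕ → Bool
  b = member S

  open Subtrees b

  in-S : ∀ {u w} → u ∈ S → u ≡ w → b w ≡ true
  in-S u∈S refl = member-true u∈S

  outside : ∀ w → 2 ^ suc n ≤ w → b w ≡ false
  outside w 2^n+1≤w with b w in bw
  ... | false = refl
  ... | true  = ⊥-elim (<⇒≱ (vertex⁻ {n} (All.lookup (proj₁ (proj₂ tds)) (member-sound bw))) 2^n+1≤w)

  child-dominated : ∀ v w w′ → Siblings v w′ w → IsVertex n w → Dominated (b v ∨ b w′) w
  child-dominated v w w′ sib vw with proj₂ (proj₂ tds) w vw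
  ... | u , u∈S , _ , _ , inj₁ u-parent =
    ∨-introˡ _ (∨-introˡ (b w′) (in-S u∈S (parent-unique {u} {v} {w} u-parent (siblings-child {v} sib))))
  ... | u , u∈S , _ , _ , inj₂ (inj₁ (inj₁ u≡2w)) =
    ∨-introʳ (b v ∨ b w′) (∨-introˡ (b (2 * w + 1)) (in-S u∈S u≡2w))
  ... | u , u∈S , _ , _ , inj₂ (inj₁ (inj₂ u≡2w+1)) =
    ∨-introʳ (b v ∨ b w′) (∨-introʳ (b (2 * w)) (in-S u∈S u≡2w+1))
  ... | u , u∈S , _ , _ , inj₂ (inj₂ (x , _ , _ , sib′)) =
    ∨-introˡ _ (∨-introʳ (b v) (in-S u∈S (sibling-unique {x} {v} {u} {w′} {w} sib′ sib)))

  -- The root has no parent or sibling, so it is dominated by a child.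
  root-dominated : Dominated false 1
  root-dominated with proj₂ (proj₂ tds) 1 (vertex⁺ {n} (s≤s z≤n) (^-monoʳ-≤ 2 {1} {suc n} (s≤s z≤n)))
  ... | u , _ , (1≤u , _) , _ , inj₁ u-parent = ⊥-elim (root-orphan 1≤u u-parent)
  ... | u , u∈S , _ , _ , inj₂ (inj₁ (inj₁ u≡2)) = ∨-introˡ (b 3) (in-S u∈S u≡2)
  ... | u , u∈S , _ , _ , inj₂ (inj₁ (inj₂ u≡3)) = ∨-introʳ (b 2) (in-S u∈S u≡3)
  ... | u , _ , _ , _ , inj₂ (inj₂ (x , 1≤x , _ , sib)) = ⊥-elim (root-orphan 1≤x (siblings-child {x} sib))

  well-dominated : ∀ h v L → Level v L → L + h ≡ n → WellDominated h v
  well-dominated zero v L level-v L+0≡n =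
    outside (2 * v) 2^n+1≤2v , outside (2 * v + 1) (≤-trans 2^n+1≤2v (m≤m+n (2 * v) 1))
    where
    2^n+1≤2v : 2 ^ suc n ≤ 2 * v
    2^n+1≤2v = subst (λ e → 2 ^ suc e ≤ 2 * v) (trans (sym (+-identityʳ L)) L+0≡n)
                     (*-monoʳ-≤ 2 (proj₁ level-v))
  well-dominated (suc h) v L level-v L+h+1≡n =
    child-dominated v (2 * v) (2 * v + 1) (inj₂ (refl , refl)) (level-vertex {n} l₀ L+1≤n) ,
    child-dominated v (2 * v + 1) (2 * v) (inj₁ (refl , refl)) (level-vertex {n} l₁ L+1≤n) ,
    well-dominated h (2 * v) (suc L) l₀ (trans (sym (+-suc L h)) L+h+1≡n) ,
    well-dominated h (2 * v + 1) (suc L) l₁ (trans (sym (+-suc L h)) L+h+1≡n)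
    where
    l₀ = child-level {v} {L = L} (inj₁ refl) level-v
    l₁ = child-level {v} {L = L} (inj₂ refl) level-v
    L+1≤n : suc L ≤ n
    L+1≤n = subst (suc L ≤_) L+h+1≡n (≤-trans (s≤s (m≤m+n L h)) (≤-reflexive (sym (+-suc L h))))

  lower-bound : bound n false false ≤ length S
  lower-bound = begin
    bound n false false
      ≤⟨ bound-mono n (b 1) ⟩
    bound n (b 1) false
      ≤⟨ subtree-lower-bound n 1 false (well-dominated n 1 0 level-1 refl) root-dominated ⟩
    treeSum χ 1 n
      ≤⟨ m≤n+m (treeSum χ 1 n) (χ 0) ⟩
    χ 0 + treeSum χ 1 n
      ≡⟨ treeSum-root χ n ⟩
    rangeSum χ 0 (2 ^ suc n)
      ≤⟨ count-members≤length S 0 (2 ^ suc n) ⟩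
    length S ∎
    where
    open ≤-Reasoning
    χ : ℕ → ℕ
    χ = indicator ∘ b
    level-1 : Level 1 0
    level-1 = ≤-refl , s≤s (s≤s z≤n)

exceptional : Phase → ℕ → Bool
exceptional r 1 = isP1 r
exceptional r 2 = true
exceptional r _ = false

-- Each chosen
-- level dominates itself (via sibling edges) and the levels just above and
-- below it.
chosen : ℕ → ℕ → Bool
chosen n w = exceptional (phase n) w ∨ ((2 ≤ᵇ w) ∧ isP1 (phase (n ∸ level w)))

level-height : ∀ n w j → level w + j ≡ n → n ∸ level w ≡ j
level-height .(level w + j) w j refl = m+n∸m≡n (level w) j

chosen-by-level : ∀ n w j → 3 ≤ w → level w + j ≡ n → chosen n w ≡ isP1 (phase j)
chosen-by-level n 0 j () _
chosen-by-level n 1 j (s≤s ()) _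
chosen-by-level n 2 j (s≤s (s≤s ())) _
chosen-by-level n (suc (suc (suc w))) j _ eq = cong (isP1 ∘ phase) (level-height n (3 + w) j eq)

chosen-on-level : ∀ n w j → 1 ≤ w → level w + j ≡ n → phase j ≡ p1 → chosen n w ≡ true
chosen-on-level n 1 j _ refl is-p1 rewrite is-p1 = refl
chosen-on-level n 2 j _ _ _ = refl
chosen-on-level n (suc (suc (suc w))) j _ eq is-p1 =
  trans (chosen-by-level n (3 + w) j (s≤s (s≤s (s≤s z≤n))) eq) (cong isP1 is-p1)

chosen-positive : ∀ n w → chosen n w ≡ true → 1 ≤ w
chosen-positive n (suc w) _ = s≤s z≤n

module Construction (n : ℕ) where

  S : List ℕ
  S = select (chosen n) 0 (2 ^ suc n)

  dominate : ∀ u w → chosen n u ≡ true → IsVertex n u → IsVertex n w →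
    IsChild u w ⊎ IsChild w u ⊎ IsSiblingEdge n u w → ∃[ u ] ((u ∈ S) × Adj n u w)
  dominate u w cu vu vw edge =
    u , ∈-select⁺ (chosen n) 0 (2 ^ suc n) z≤n (vertex⁻ {n} vu) cu , vu , vw , edge

  -- With j
  -- the height of the subtree of w: if j ≡ 1 the sibling w′ is chosen, if
  -- j + 1 ≡ 1 the parent v is chosen, otherwise the child 2w is chosen.
  module ChildDomination (v w w′ : ℕ) (1≤v : 1 ≤ v) (sib : Siblings v w′ w) (vw : IsVertex n w) where

    c : IsChild v w
    c = siblings-child {v} sib

    c′ : IsChild v w′
    c′ = siblings-child {v} (siblings-sym {v} sib)

    j : ℕ
    j = n ∸ level w

    height : level w + j ≡ n
    height = m+[n∸m]≡n (vertex-level {n} vw)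

    v<2^n : v < 2 ^ n
    v<2^n = parent< {v} c (vertex⁻ {n} vw)

    dominated : ∃[ u ] ((u ∈ S) × Adj n u w)
    dominated with phase-cases j
    ... | inj₁ j-chosen =
      dominate w′ w (chosen-on-level n w′ j 1≤w′ (trans (cong (_+ j) same-level) height) j-chosen)
               (vertex⁺ {n} 1≤w′ (child< {v} c′ v<2^n)) vw
               (inj₂ (inj₂ (v , 1≤v , m<M⇒m≤M∸1 (2 ^ n) v<2^n , sib)))
      where
      1≤w′ : 1 ≤ w′
      1≤w′ = ≤-trans (s≤s z≤n) (child-≥2 {v} 1≤v c′)
      same-level : level w′ ≡ level w
      same-level = trans (level-child {v} 1≤v c′) (sym (level-child {v} 1≤v c))
    ... | inj₂ (inj₁ j+1-chosen) =
      dominate v w (chosen-on-level n v (suc j) 1≤v parent-height j+1-chosen)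
               (vertex⁺ {n} 1≤v (≤-trans v<2^n (m≤n*m (2 ^ n) 2))) vw (inj₁ c)
      where
      parent-height : level v + suc j ≡ n
      parent-height = trans (+-suc (level v) j) (trans (cong (_+ j) (sym (level-child {v} 1≤v c))) height)
    ... | inj₂ (inj₂ (j′ , j≡1+j′ , j′-chosen)) =
      dominate (2 * w) w
               (chosen-on-level n (2 * w) j′ 1≤2w (child-height {v = w} 1≤w (inj₁ refl) w-height) j′-chosen)
               (level-vertex {n} (child-level {w} {L = level w} (inj₁ refl) (level-spec {w} 1≤w)) level-2w≤n)
               vw
               (inj₂ (inj₁ (inj₁ refl)))
      where
      1≤w : 1 ≤ w
      1≤w = proj₁ vw
      1≤2w : 1 ≤ 2 * w
      1≤2w = ≤-trans 1≤w (m≤n*m w 2)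
      w-height : level w + suc j′ ≡ n
      w-height = trans (cong (level w +_) (sym j≡1+j′)) height
      level-2w≤n : suc (level w) ≤ n
      level-2w≤n = subst (level w <_) w-height (m<m+n (level w) (s≤s z≤n))

  root-dominated : 1 ≤ n → ∃[ u ] ((u ∈ S) × Adj n u 1)
  root-dominated 1≤n =
    dominate 2 1 refl (vertex⁺ {n} (s≤s z≤n) 2<2^n+1)
             (vertex⁺ {n} (s≤s z≤n) (≤-trans (s≤s (s≤s z≤n)) 2<2^n+1))
             (inj₂ (inj₁ (inj₁ refl)))
    where
    2<2^n+1 : 2 < 2 ^ suc n
    2<2^n+1 = ≤-trans (s≤s (s≤s (s≤s (z≤n {1})))) (^-monoʳ-≤ 2 {2} {suc n} (s≤s 1≤n))

  is-tds : 1 ≤ n → IsTotalDominatingSet n S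
  is-tds 1≤n = select-unique (chosen n) 0 (2 ^ suc n) ,
    All.tabulate (λ {u} u∈S → let (_ , u< , cu) = ∈-select⁻ (chosen n) 0 (2 ^ suc n) u∈S
                              in vertex⁺ {n} (chosen-positive n u cu) u<) ,
    dominated
    where
    dominated : ∀ w → IsVertex n w → ∃[ u ] ((u ∈ S) × Adj n u w)
    dominated zero (() , _)
    dominated 1 _ = root-dominated 1≤n
    dominated (suc (suc w)) vw with parent-exists (2 + w) (s≤s (s≤s z≤n))
    ... | v , w′ , 1≤v , sib = ChildDomination.dominated v (2 + w) w′ 1≤v sib vw

-- The number of chosen vertices in a subtree of height h that reaches the
-- leaves of ST_n and avoids the exceptional vertices: its levels of height
-- ≡ 1 (mod 3) contribute 2^(h − height) each.
levelCount : ℕ → ℕ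
levelCount zero    = 0
levelCount (suc h) = indicator (isP1 (phase (suc h))) + (levelCount h + levelCount h)

subtree-count : ∀ n h v → 3 ≤ v → level v + h ≡ n → treeSum (indicator ∘ chosen n) v h ≡ levelCount h
subtree-count n zero v 3≤v height = cong indicator (chosen-by-level n v 0 3≤v height)
subtree-count n (suc h) v 3≤v height =
  begin
    indicator (chosen n v) + (treeSum χ (2 * v) h + treeSum χ (2 * v + 1) h)
      ≡⟨ cong₂ (λ x y → indicator x + y) (chosen-by-level n v (suc h) 3≤v height)
               (cong₂ _+_ (subtree-count n h (2 * v) 3≤2v (child-height {v = v} 1≤v (inj₁ refl) height))
                          (subtree-count n h (2 * v + 1) (≤-trans 3≤2v (m≤m+n (2 * v) 1))
                                         (child-height {v = v} 1≤v (inj₂ refl) height))) ⟩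
    levelCount (suc h) ∎
  where
  open ≡-Reasoning
  χ : ℕ → ℕ
  χ = indicator ∘ chosen n
  1≤v : 1 ≤ v
  1≤v = ≤-trans (s≤s z≤n) 3≤v
  3≤2v : 3 ≤ 2 * v
  3≤2v = ≤-trans 3≤v (m≤n*m v 2)

levelExcess : Phase → ℕ
levelExcess p0 = 0
levelExcess p1 = 1
levelExcess p2 = 2

levelCount-closed : ∀ h → levelCount h ≡ base h + levelExcess (phase h)
levelCount-closed zero    = refl
levelCount-closed (suc h) = begin
  indicator (isP1 (next r)) + (levelCount h + levelCount h)
    ≡⟨ cong (λ k → indicator (isP1 (next r)) + (k + k)) (levelCount-closed h) ⟩
  indicator (isP1 (next r)) + (B + levelExcess r + (B + levelExcess r))
    ≡⟨ regroup (indicator (isP1 (next r))) B (levelExcess r) ⟩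
  (indicator (isP1 (next r)) + 2 * levelExcess r) + 2 * B
    ≡⟨ cong (_+ 2 * B) (excess-next r) ⟩
  (offset r + levelExcess (next r)) + 2 * B
    ≡⟨ regroup′ (offset r) (levelExcess (next r)) B ⟩
  offset r + 2 * B + levelExcess (next r) ∎
  where
  open ≡-Reasoning
  r = phase h
  B = base h
  excess-next : ∀ r → indicator (isP1 (next r)) + 2 * levelExcess r ≡ offset r + levelExcess (next r)
  excess-next p0 = refl
  excess-next p1 = refl
  excess-next p2 = refl
  regroup : ∀ i B e → i + (B + e + (B + e)) ≡ (i + 2 * e) + 2 * B
  regroup = solve-∀
  regroup′ : ∀ o e B → (o + e) + 2 * B ≡ o + 2 * B + e
  regroup′ = solve-∀

-- The chosen set has bound n false false elements: for n = h + 2 the tree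
-- consists of the root 1, the vertex 2 with the subtrees at 4 and 5, and the
-- subtree at 3.
tree-count : ∀ n → 1 ≤ n → treeSum (indicator ∘ chosen n) 1 n ≡ bound n false false
tree-count 1 _ = refl
tree-count (suc (suc h)) _
  rewrite ∨-identityʳ (isP1 (phase (2 + h)))
        | subtree-count (2 + h) h 4 (s≤s (s≤s (s≤s z≤n))) refl
        | subtree-count (2 + h) h 5 (s≤s (s≤s (s≤s z≤n))) refl
        | subtree-count (2 + h) (suc h) 3 ≤-refl refl
        | levelCount-closed h
  = begin
    i₂ + (1 + (X + X + (i₁ + (X + X))))   ≡⟨ collect i₂ i₁ (base h) (levelExcess r) ⟩
    (i₂ + 1 + i₁ + 4 * levelExcess r) + 4 * base h
      ≡⟨ cong (_+ 4 * base h) (tree-constant r) ⟩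
    (offset (next r) + 2 * offset r + excess (next (next r)) false false) + 4 * base h
      ≡⟨ spread (offset (next r)) (offset r) (base h) (excess (next (next r)) false false) ⟩
    offset (next r) + 2 * (offset r + 2 * base h) + excess (next (next r)) false false ∎
  where
  open ≡-Reasoning
  r = phase h
  X = base h + levelExcess r
  i₁ = indicator (isP1 (next r))
  i₂ = indicator (isP1 (next (next r)))
  tree-constant : ∀ r → indicator (isP1 (next (next r))) + 1 + indicator (isP1 (next r)) + 4 * levelExcess r
                        ≡ offset (next r) + 2 * offset r + excess (next (next r)) false false
  tree-constant p0 = refl
  tree-constant p1 = refl
  tree-constant p2 = refl
  collect : ∀ i₂ i₁ B k → i₂ + (1 + (B + k + (B + k) + (i₁ + (B + k + (B + k)))))
                          ≡ (i₂ + 1 + i₁ + 4 * k) + 4 * B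
  collect = solve-∀
  spread : ∀ o₁ o₀ B e → (o₁ + 2 * o₀ + e) + 4 * B ≡ o₁ + 2 * (o₀ + 2 * B) + e
  spread = solve-∀

upper-bound : ∀ n → 1 ≤ n → ∃[ S ] (IsTotalDominatingSet n S × length S ≡ bound n false false)
upper-bound n 1≤n = S , is-tds 1≤n , (begin
  length S                                    ≡⟨ select-length (chosen n) 0 (2 ^ suc n) ⟩
  rangeSum (indicator ∘ chosen n) 0 (2 ^ suc n) ≡⟨ sym (treeSum-root (indicator ∘ chosen n) n) ⟩
  treeSum (indicator ∘ chosen n) 1 n          ≡⟨ tree-count n 1≤n ⟩
  bound n false false                         ∎)
  where
  open Construction n
  open ≡-Reasoning

theorem6 : (n : ℕ) → 1 ≤ n →
    ∃[ k ] (TotalDominationNumber n k ×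
    (n % 3 ≡ 0 → 7 * k ≡ 2 ^ (n + 2) + 3) ×
    (n % 3 ≡ 1 → 7 * k ≡ (2 ^ (n + 2) ∸ 1) + 7) ×
    (n % 3 ≡ 2 → 7 * k ≡ 2 * (2 ^ (n + 1) ∸ 1)))
theorem6 n 1≤n =
  bound n false false ,
  (upper-bound n 1≤n , TotalDominatingSetBound.lower-bound n) ,
  bound-value n
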